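{- Let $S\subseteq\mathbb{Z}$ be nonempty and let $a_0,a_1,\dots,a_n$ be any $n+1$ integers in $S$. Then for any $\mathcal{T}\subseteq\mathbb{N}$, the product $$\prod_{b\in\mathcal{T}} b^{\gamma(S,b,\mathbf{a})},\qquad \gamma(S,b,\mathbf{a}):=\sum_{0\le i<j\le n}\operatorname{ord}_b(a_i-a_j),$$ is a multiple of $0!_{S,\mathcal{T}}\,1!_{S,\mathcal{T}}\cdots n!_{S,\mathcal{T}}$.
   Context: For integers $b\ge0$ and $a\in\mathbb{Z}$ let $\operatorname{ord}_b(a):=\sup\{k\in\mathbb{N}: a\mathbb{Z}\subseteq b^k\mathbb{Z}\}$ (convention $0^0=1$); for $b\ge2$ this is the largest $k$ with $b^k\mid a$, $\operatorname{ord}_b(0)=+\infty$; $\operatorname{ord}_1\equiv+\infty$; $\operatorname{ord}_0(a)=0$ for $a\ne0$, $\operatorname{ord}_0(0)=+\infty$. For nonempty $S\subseteq\mathbb{Z}$, a $b$-ordering of $S$ is an infinite sequence $(a_i)_{i\ge0}$ in $S$ such that for every $i\ge1$, $\sum_{j<i}\operatorname{ord}_b(a_i-a_j)=\min_{a'\in S}\sum_{j<i}\operatorname{ord}_b(a'-a_j)$. The quantity $\alpha_k(S,b):=\sum_{j<k}\operatorname{ord}_b(a_k-a_j)$ (with $\alpha_0=0$) does not depend on the choice of $b$-ordering. For $\mathcal{T}\subseteq\mathbb{N}$, $k!_{S,\mathcal{T}}:=\prod_{b\in\mathcal{T}}b^{\alpha_k(S,b)}$, with conventions $b^{+\infty}=0$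 for $b\ge2$ and $b=0$, $1^{+\infty}=1$, and $b^0=1$ for all $b$ (the same conventions apply to $b^{\gamma}$). -}

module Defs where

open import Data.Nat using (ℕ; zero; suc; _+_; _*_; _^_; _≤_)
open import Data.Nat.DivMod using (_/_)
open import Data.Nat.Divisibility using (_∣?_)
open import Data.Integer as ℤ using (ℤ; ∣_∣; _-_)
open import Data.List using (List; map)
open import Data.Nat.ListAction using (product)
open import Data.List.Membership.Propositional using (_∈_; _∉_)
open import Data.List.Relation.Unary.All using (All)
open import Data.List.Relation.Unary.Unique.Propositional using (Unique)
open import Data.Product using (Σ; ∃; _×_)
open import Data.Sum using (_⊎_)
open import Relation.Nullary using (¬_; yes; no)
open import Relation.Binary.PropositionalEquality using (_≡_)

data ℕ∞ : Set where
  fin : ℕ → ℕ∞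
  ∞   : ℕ∞

infixl 6 _+∞_
_+∞_ : ℕ∞ → ℕ∞ → ℕ∞
fin m +∞ fin n = fin (m + n)
fin _ +∞ ∞     = ∞
∞     +∞ _     = ∞

infix 4 _≤∞_
data _≤∞_ : ℕ∞ → ℕ∞ → Set where
  fin≤fin : ∀ {m n} → m ≤ n → fin m ≤∞ fin n
  _≤∞∞    : ∀ x → x ≤∞ ∞

-- b ^ γ with the conventions b^{+∞} = 0 for b ≥ 2 and b = 0, 1^{+∞} = 1, b^0 = 1 (also 0^0 = 1)
_^∞_ : ℕ → ℕ∞ → ℕ
b ^∞ fin k = b ^ k
zero ^∞ ∞ = 0
suc zero ^∞ ∞ = 1
suc (suc _) ^∞ ∞ = 0

ordGo : ℕ → ℕ → ℕ → ℕ
ordGo zero c n = 0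
ordGo (suc f) c n with suc (suc c) ∣? n
... | yes _ = suc (ordGo f c (n / suc (suc c)))
... | no _  = 0

-- ord_b(a) = sup { k : aℤ ⊆ b^k ℤ }
ord : ℕ → ℤ → ℕ∞
ord zero a with ∣ a ∣
... | zero  = ∞
... | suc _ = fin 0
ord (suc zero) a = ∞
ord (suc (suc c)) a with ∣ a ∣
... | zero  = ∞
... | suc m = fin (ordGo (suc m) c (suc m))

Σ< : ℕ → (ℕ → ℕ∞) → ℕ∞
Σ< zero f = fin 0
Σ< (suc k) f = Σ< k f +∞ f k

ordSum : ℕ → (ℕ → ℤ) → ℕ → ℤ → ℕ∞
ordSum b a i x = Σ< i (λ j → ord b (x - a j))

IsBOrdering : (ℤ → Set) → ℕ → (ℕ → ℤ) → Set
IsBOrdering S b a =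
  (∀ i → S (a i)) ×
  (∀ i → 1 ≤ i → ∀ a' → S a' → ordSum b a i (a i) ≤∞ ordSum b a i a')

α : ℕ → (ℕ → ℤ) → ℕ → ℕ∞
α b a k = ordSum b a k (a k)

γ : ℕ → (ℕ → ℤ) → ℕ → ℕ∞
γ b a n = Σ< (suc n) (λ j → Σ< j (λ i → ord b (a i - a j)))

-- m is the (possibly infinite) product ∏_{b ∈ T} f b : either some factor is 0 (and m = 0),
-- or all factors ≠ 1 lie in a finite duplicate-free list L ⊆ T and m is the product over L.
IsProd : (ℕ → Set) → (ℕ → ℕ) → ℕ → Set
IsProd T f m =
  ((∃ λ b → T b × f b ≡ 0) × m ≡ 0) ⊎
  (Σ (List ℕ) λ L → Unique L × All T L × (∀ b → T b → ¬ (f b ≡ 1) → b ∈ L) × m ≡ product (map f L))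

∏≤ : ℕ → (ℕ → ℕ) → ℕ
∏≤ zero g = g 0
∏≤ (suc n) g = ∏≤ n g * g (suc n)

-- Fix b and write d(x, y) = ord_b(x − y). Since b^k ∣ x − y and b^k ∣ y − z give
-- b^k ∣ x − z, d is an ultrametric closeness: d(x, z) ≥ min(d(x, y), d(y, z)).
-- This lets one pick, among any n + 1 points of S, a point x whose total closeness
-- to the other n points is at least its total closeness to the first n terms of a
-- b-ordering, and the latter is at least α_n by minimality of the b-ordering.
-- Removing x and inducting gives α₀ + ⋯ + αₙ ≤ γ(S, b, a) for every b, so
-- b^{α₀} ⋯ b^{αₙ} divides b^γ. Every factor b^{α_k} ≠ 1 of k!_{S,T} then belongs to
-- the factors b^γ ≠ 1 defining the product, whence the divisibility.

module Submission where

open import Defs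
open import Algebra.Bundles using (CommutativeSemigroup)
import Algebra.Properties.CommutativeSemigroup as CommSemigroupProperties
open import Data.Empty using (⊥-elim)
open import Data.Integer using (ℤ; ∣_∣; _-_; +_)
open import Data.Integer.Properties using (∣i-j∣≡∣j-i∣; +-minus-telescope)
import Data.Integer.Divisibility.Signed as ℤ∣
open import Data.List using (List; []; _∷_; _++_; map; length; applyDownFrom)
open import Data.List.Properties using (map-cong; length-applyDownFrom)
open import Data.List.Membership.Propositional using (_∈_)
open import Data.List.Membership.Propositional.Properties using (∈-∃++; ∈-map⁺)
open import Data.List.Relation.Unary.All as All using (All; []; _∷_)
open import Data.List.Relation.Unary.Any using (here; there)
open import Data.List.Relation.Unary.AllPairs using (_∷_)
open import Data.List.Relation.Unary.Unique.Propositional using (Unique)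
open import Data.List.Relation.Binary.Permutation.Propositional
  using (_↭_; refl; prep; swap; trans; ↭-sym)
open import Data.List.Relation.Binary.Permutation.Propositional.Properties
  using (All-resp-↭; ∈-resp-↭; ↭-length; shift; map⁺)
open import Data.Nat using (ℕ; zero; suc; _+_; _*_; _^_; _≤_; _<_; _∸_; z≤n; s≤s; >-nonZero; _≟_)
open import Data.Nat.DivMod using (_/_; m*[n/m]≡n; m/n<m; m≥n⇒m/n>0)
open import Data.Nat.Divisibility
  using (_∣_; divides; _∣0; 1∣_; 0∣⇒≡0; ∣1⇒≡1; ∣-refl; ∣-trans; ∣-reflexive; ∣⇒≤;
         m*n∣⇒m∣; *-monoʳ-∣; *-pres-∣; *-cancelˡ-∣; _∣?_; module ∣-Reasoning)
open import Data.Nat.ListAction using (product)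
open import Data.Nat.ListAction.Properties using (product-↭; ∈⇒∣product)
open import Data.Nat.Properties
  using (≤-refl; ≤-trans; ≤-total; ≤-pred; +-comm; +-assoc; +-mono-≤; m≤m+n; m≤n⇒m≤1+n;
         m≤n⇒m<n∨m≡n; <-irrefl; <-≤-trans; <⇒≱; suc-injective; 0≢1+n;
         *-zeroʳ; *-identityˡ; *-comm; *-commutativeSemigroup; ^-zeroˡ; ^-distribˡ-+-*; m+[n∸m]≡n)
open import Data.Product using (Σ; ∃; _×_; _,_; proj₂)
open import Data.Sum using (_⊎_; inj₁; inj₂)
open import Function using (_∘_)
open import Relation.Nullary using (yes; no)
open import Relation.Binary.PropositionalEquality
  using (_≡_; _≢_; cong; cong₂; subst; sym; isMagma; module ≡-Reasoning)
  renaming (refl to ≡-refl; trans to ≡-trans)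

≤∞-refl : ∀ x → x ≤∞ x
≤∞-refl (fin n) = fin≤fin ≤-refl
≤∞-refl ∞       = ∞ ≤∞∞

≤∞-trans : ∀ {x y z} → x ≤∞ y → y ≤∞ z → x ≤∞ z
≤∞-trans (fin≤fin p) (fin≤fin q) = fin≤fin (≤-trans p q)
≤∞-trans {x} _       (_ ≤∞∞)     = x ≤∞∞

≤∞-total : ∀ x y → x ≤∞ y ⊎ y ≤∞ x
≤∞-total (fin m) (fin n) with ≤-total m n
... | inj₁ m≤n = inj₁ (fin≤fin m≤n)
... | inj₂ n≤m = inj₂ (fin≤fin n≤m)
≤∞-total x       ∞       = inj₁ (x ≤∞∞)
≤∞-total ∞       y       = inj₂ (y ≤∞∞)

∞≤⇒fin≤ : ∀ k {x} → ∞ ≤∞ x → fin k ≤∞ x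
∞≤⇒fin≤ k (_ ≤∞∞) = fin k ≤∞∞

fin≤⇒∞≤ : ∀ x → (∀ k → fin k ≤∞ x) → ∞ ≤∞ x
fin≤⇒∞≤ (fin m) below with below (suc m)
... | fin≤fin 1+m≤m = ⊥-elim (<-irrefl ≡-refl 1+m≤m)
fin≤⇒∞≤ ∞       _     = ∞ ≤∞∞

+∞-comm : ∀ x y → x +∞ y ≡ y +∞ x
+∞-comm (fin m) (fin n) = cong fin (+-comm m n)
+∞-comm (fin m) ∞       = ≡-refl
+∞-comm ∞       (fin n) = ≡-refl
+∞-comm ∞       ∞       = ≡-refl

+∞-assoc : ∀ x y z → (x +∞ y) +∞ z ≡ x +∞ (y +∞ z)
+∞-assoc (fin l) (fin m) (fin n) = cong fin (+-assoc l m n)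
+∞-assoc (fin l) (fin m) ∞       = ≡-refl
+∞-assoc (fin l) ∞       z       = ≡-refl
+∞-assoc ∞       y       z       = ≡-refl

+∞-identityˡ : ∀ x → fin 0 +∞ x ≡ x
+∞-identityˡ (fin n) = ≡-refl
+∞-identityˡ ∞       = ≡-refl

+∞-commutativeSemigroup : CommutativeSemigroup _ _
+∞-commutativeSemigroup = record
  { isCommutativeSemigroup = record
    { isSemigroup = record { isMagma = isMagma _+∞_ ; assoc = +∞-assoc }
    ; comm        = +∞-comm
    }
  }

open CommSemigroupProperties +∞-commutativeSemigroup using (interchange; xy∙z≈xz∙y)

+∞-mono-≤∞ : ∀ {w x y z} → w ≤∞ x → y ≤∞ z → w +∞ y ≤∞ x +∞ z
+∞-mono-≤∞         (fin≤fin p) (fin≤fin q) = fin≤fin (+-mono-≤ p q)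
+∞-mono-≤∞ {w} {y = y} (fin≤fin _) (_ ≤∞∞) = (w +∞ y) ≤∞∞
+∞-mono-≤∞ {w} {y = y} (_ ≤∞∞)     _       = (w +∞ y) ≤∞∞

x≤∞x+∞y : ∀ x y → x ≤∞ x +∞ y
x≤∞x+∞y (fin m) (fin n) = fin≤fin (m≤m+n m n)
x≤∞x+∞y (fin m) ∞       = fin m ≤∞∞
x≤∞x+∞y ∞       y       = ∞ ≤∞∞

x≤∞y+∞x : ∀ x y → x ≤∞ y +∞ x
x≤∞y+∞x x y = subst (x ≤∞_) (+∞-comm x y) (x≤∞x+∞y x y)

Σ<-cong : ∀ n {f g : ℕ → ℕ∞} → (∀ i → f i ≡ g i) → Σ< n f ≡ Σ< n g
Σ<-cong zero    f≗g = ≡-refl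
Σ<-cong (suc n) f≗g = cong₂ _+∞_ (Σ<-cong n f≗g) (f≗g n)

term≤∞Σ< : ∀ (f : ℕ → ℕ∞) {n k} → k < n → f k ≤∞ Σ< n f
term≤∞Σ< f {suc n} {k} (s≤s k≤n) with m≤n⇒m<n∨m≡n k≤n
... | inj₁ k<n     = ≤∞-trans (term≤∞Σ< f k<n) (x≤∞x+∞y (Σ< n f) (f n))
... | inj₂ ≡-refl  = x≤∞y+∞x (f k) (Σ< k f)

ordGo-sound : ∀ f c n k → k ≤ ordGo f c n → suc (suc c) ^ k ∣ n
ordGo-sound f       c n zero    _ = 1∣ n
ordGo-sound (suc f) c n (suc k) k<go with suc (suc c) ∣? n | k<go
... | yes b∣n | s≤s k≤go = subst (suc (suc c) ^ suc k ∣_) (m*[n/m]≡n b∣n)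
                             (*-monoʳ-∣ (suc (suc c)) (ordGo-sound f c (n / suc (suc c)) k k≤go))

ordGo-complete : ∀ f c n k → 1 ≤ n → n ≤ f → suc (suc c) ^ k ∣ n → k ≤ ordGo f c n
ordGo-complete f       c n zero    _   _   _     = z≤n
ordGo-complete zero    c n (suc k) 1≤n n≤0 _     = ⊥-elim (<⇒≱ 1≤n n≤0)
ordGo-complete (suc f) c n (suc k) 1≤n n≤f bᵏ⁺¹∣n with suc (suc c) ∣? n
... | no  b∤n = ⊥-elim (b∤n (m*n∣⇒m∣ (suc (suc c)) (suc (suc c) ^ k) bᵏ⁺¹∣n))
... | yes b∣n = s≤s (ordGo-complete f c (n / b) k 1≤n/b n/b≤f bᵏ∣n/b)
  where
  b = suc (suc c)
  instance _ = >-nonZero 1≤n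
  1≤n/b : 1 ≤ n / b
  1≤n/b = m≥n⇒m/n>0 (∣⇒≤ b∣n)
  n/b≤f : n / b ≤ f
  n/b≤f = ≤-pred (<-≤-trans (m/n<m n b (s≤s (s≤s z≤n))) n≤f)
  bᵏ∣n/b : b ^ k ∣ n / b
  bᵏ∣n/b = *-cancelˡ-∣ b (subst (b * b ^ k ∣_) (sym (m*[n/m]≡n b∣n)) bᵏ⁺¹∣n)

ord-∣∣ : ∀ b z → ord b z ≡ ord b (+ ∣ z ∣)
ord-∣∣ zero          z = ≡-refl
ord-∣∣ (suc zero)    z = ≡-refl
ord-∣∣ (suc (suc c)) z = ≡-refl

≤ord+⇒^∣ : ∀ b n k → fin k ≤∞ ord b (+ n) → b ^ k ∣ n
≤ord+⇒^∣ zero          zero    k       _           = (0 ^ k) ∣0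
≤ord+⇒^∣ zero          (suc n) zero    _           = 1∣ suc n
≤ord+⇒^∣ zero          (suc n) (suc k) (fin≤fin ())
≤ord+⇒^∣ (suc zero)    n       k       _           = subst (_∣ n) (sym (^-zeroˡ k)) (1∣ n)
≤ord+⇒^∣ (suc (suc c)) zero    k       _           = _ ∣0
≤ord+⇒^∣ (suc (suc c)) (suc n) k       (fin≤fin p) = ordGo-sound (suc n) c (suc n) k p

^∣⇒≤ord+ : ∀ b n k → b ^ k ∣ n → fin k ≤∞ ord b (+ n)
^∣⇒≤ord+ zero          zero    k       _     = fin k ≤∞∞
^∣⇒≤ord+ zero          (suc n) zero    _     = fin≤fin z≤n
^∣⇒≤ord+ zero          (suc n) (suc k) 0∣1+n with () ← 0∣⇒≡0 0∣1+n
^∣⇒≤ord+ (suc zero)    n       k       _     = fin k ≤∞∞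
^∣⇒≤ord+ (suc (suc c)) zero    k       _     = fin k ≤∞∞
^∣⇒≤ord+ (suc (suc c)) (suc n) k       bᵏ∣n  =
  fin≤fin (ordGo-complete (suc n) c (suc n) k (s≤s z≤n) ≤-refl bᵏ∣n)

≤ord⇒^∣ : ∀ b z k → fin k ≤∞ ord b z → + (b ^ k) ℤ∣.∣ z
≤ord⇒^∣ b z k = ℤ∣.∣ᵤ⇒∣ ∘ ≤ord+⇒^∣ b ∣ z ∣ k ∘ subst (fin k ≤∞_) (ord-∣∣ b z)

^∣⇒≤ord : ∀ b z k → + (b ^ k) ℤ∣.∣ z → fin k ≤∞ ord b z
^∣⇒≤ord b z k = subst (fin k ≤∞_) (sym (ord-∣∣ b z)) ∘ ^∣⇒≤ord+ b ∣ z ∣ k ∘ ℤ∣.∣⇒∣ᵤ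

ordDiff : ℕ → ℤ → ℤ → ℕ∞
ordDiff b x y = ord b (x - y)

ordDiff-sym : ∀ b x y → ordDiff b x y ≡ ordDiff b y x
ordDiff-sym b x y = begin
  ord b (x - y)         ≡⟨ ord-∣∣ b (x - y) ⟩
  ord b (+ ∣ x - y ∣)   ≡⟨ cong (ord b ∘ +_) (∣i-j∣≡∣j-i∣ x y) ⟩
  ord b (+ ∣ y - x ∣)   ≡⟨ sym (ord-∣∣ b (y - x)) ⟩
  ord b (y - x)         ∎
  where open ≡-Reasoning

ordDiff-ultrametric : ∀ b x y z t → t ≤∞ ordDiff b x y → t ≤∞ ordDiff b y z → t ≤∞ ordDiff b x z
ordDiff-ultrametric b x y z (fin k) p q = ^∣⇒≤ord b (x - z) k
  (subst (+ (b ^ k) ℤ∣.∣_) (+-minus-telescope x y z)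
    (ℤ∣.∣m∣n⇒∣m+n (≤ord⇒^∣ b (x - y) k p) (≤ord⇒^∣ b (y - z) k q)))
ordDiff-ultrametric b x y z ∞ p q = fin≤⇒∞≤ _ λ k →
  ordDiff-ultrametric b x y z (fin k) (∞≤⇒fin≤ k p) (∞≤⇒fin≤ k q)

ordDiffSum : ℕ → ℤ → List ℤ → ℕ∞
ordDiffSum b x []       = fin 0
ordDiffSum b x (y ∷ ys) = ordDiffSum b x ys +∞ ordDiff b x y

pairSum : ℕ → List ℤ → ℕ∞
pairSum b []       = fin 0
pairSum b (y ∷ ys) = pairSum b ys +∞ ordDiffSum b y ys

ordDiffSum-↭ : ∀ b x {xs ys} → xs ↭ ys → ordDiffSum b x xs ≡ ordDiffSum b x ys
ordDiffSum-↭ b x refl         = ≡-refl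
ordDiffSum-↭ b x (prep y p)   = cong (_+∞ ordDiff b x y) (ordDiffSum-↭ b x p)
ordDiffSum-↭ b x (swap y z p) =
  ≡-trans (cong (λ s → (s +∞ ordDiff b x z) +∞ ordDiff b x y) (ordDiffSum-↭ b x p)) (xy∙z≈xz∙y _ _ _)
ordDiffSum-↭ b x (trans p q)  = ≡-trans (ordDiffSum-↭ b x p) (ordDiffSum-↭ b x q)

pairSum-↭ : ∀ b {xs ys} → xs ↭ ys → pairSum b xs ≡ pairSum b ys
pairSum-↭ b refl        = ≡-refl
pairSum-↭ b (prep x p)  = cong₂ _+∞_ (pairSum-↭ b p) (ordDiffSum-↭ b x p)
pairSum-↭ b (swap {xs} {ys} x y p) = begin
  (pairSum b xs +∞ ordDiffSum b y xs) +∞ (ordDiffSum b x xs +∞ ordDiff b x y)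
    ≡⟨ interchange _ _ _ _ ⟩
  (pairSum b xs +∞ ordDiffSum b x xs) +∞ (ordDiffSum b y xs +∞ ordDiff b x y)
    ≡⟨ cong₂ (λ s t → (s +∞ ordDiffSum b x xs) +∞ (ordDiffSum b y xs +∞ t))
             (pairSum-↭ b p) (ordDiff-sym b x y) ⟩
  (pairSum b ys +∞ ordDiffSum b x xs) +∞ (ordDiffSum b y xs +∞ ordDiff b y x)
    ≡⟨ cong₂ (λ s t → (pairSum b ys +∞ s) +∞ (t +∞ ordDiff b y x))
             (ordDiffSum-↭ b x p) (ordDiffSum-↭ b y p) ⟩
  (pairSum b ys +∞ ordDiffSum b x ys) +∞ (ordDiffSum b y ys +∞ ordDiff b y x) ∎
  where open ≡-Reasoning
pairSum-↭ b (trans p q) = ≡-trans (pairSum-↭ b p) (pairSum-↭ b q)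

extract-max : (f : ℤ → ℕ∞) (x : ℤ) (xs : List ℤ) →
  Σ ℤ λ y → Σ (List ℤ) λ ys → (x ∷ xs) ↭ (y ∷ ys) × All (λ z → f z ≤∞ f y) ys
extract-max f x []        = x , [] , refl , []
extract-max f x (x′ ∷ xs) with extract-max f x′ xs
... | y , ys , p , ys≤y with ≤∞-total (f x) (f y)
...   | inj₁ x≤y = y , x ∷ ys , trans (prep x p) (swap x y refl) , x≤y ∷ ys≤y
...   | inj₂ y≤x = x , x′ ∷ xs , refl ,
          All-resp-↭ (↭-sym p) (y≤x ∷ All.map (λ z≤y → ≤∞-trans z≤y y≤x) ys≤y)

-- Induction on A: remove the point xₖ of X closest to the head a of A, choose xⱼ for
-- the tail; then ord(xⱼ − a) ≤ ord(xⱼ − xₖ) because ord(xₖ − a) ≥ ord(xⱼ − a).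
∃-point-ordDiffSum-≤-rest : ∀ b (A X : List ℤ) → length X ≡ suc (length A) →
  Σ ℤ λ x → Σ (List ℤ) λ Y → X ↭ (x ∷ Y) × ordDiffSum b x A ≤∞ ordDiffSum b x Y
∃-point-ordDiffSum-≤-rest b []      (x ∷ []) _ = x , [] , refl , ≤∞-refl _
∃-point-ordDiffSum-≤-rest b (a ∷ A) (x ∷ X)  |X|≡2+|A|
  with extract-max (λ z → ordDiff b z a) x X
... | xₖ , Y , X↭xₖY , Y≤xₖ
  with ∃-point-ordDiffSum-≤-rest b A Y (suc-injective (≡-trans (sym (↭-length X↭xₖY)) |X|≡2+|A|))
...   | xⱼ , Y′ , Y↭xⱼY′ , A≤Y′ =
  xⱼ , xₖ ∷ Y′ , trans X↭xₖY (trans (prep xₖ Y↭xⱼY′) (swap xₖ xⱼ refl)) , +∞-mono-≤∞ A≤Y′ xⱼa≤xⱼxₖ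
  where
  xⱼxⱼa≤xⱼxₖa : ordDiff b xⱼ a ≤∞ ordDiff b xₖ a
  xⱼxⱼa≤xⱼxₖa with All-resp-↭ Y↭xⱼY′ Y≤xₖ
  ... | h ∷ _ = h
  xⱼa≤xⱼxₖ : ordDiff b xⱼ a ≤∞ ordDiff b xⱼ xₖ
  xⱼa≤xⱼxₖ = ordDiff-ultrametric b xⱼ a xₖ _ (≤∞-refl _) (subst (_ ≤∞_) (ordDiff-sym b xₖ a) xⱼxⱼa≤xⱼxₖa)

ordDiffSum-applyDownFrom : ∀ b x a n →
  ordDiffSum b x (applyDownFrom a n) ≡ Σ< n (λ j → ordDiff b x (a j))
ordDiffSum-applyDownFrom b x a zero    = ≡-refl
ordDiffSum-applyDownFrom b x a (suc n) =
  cong (_+∞ ordDiff b x (a n)) (ordDiffSum-applyDownFrom b x a n)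

pairSum-applyDownFrom : ∀ b a n → pairSum b (applyDownFrom a (suc n)) ≡ γ b a n
pairSum-applyDownFrom b a n = go (suc n)
  where
  go : ∀ m → pairSum b (applyDownFrom a m) ≡ Σ< m (λ j → Σ< j (λ i → ord b (a i - a j)))
  go zero    = ≡-refl
  go (suc m) = cong₂ _+∞_ (go m)
    (≡-trans (ordDiffSum-applyDownFrom b (a m) a m) (Σ<-cong m (λ i → ordDiff-sym b (a m) (a i))))

All-applyDownFrom : ∀ {P : ℤ → Set} (a : ℕ → ℤ) n → (∀ i → i < n → P (a i)) → All P (applyDownFrom a n)
All-applyDownFrom a zero    Pa = []
All-applyDownFrom a (suc n) Pa = Pa n ≤-refl ∷ All-applyDownFrom a n (λ i i<n → Pa i (m≤n⇒m≤1+n i<n))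

module _ (S : ℤ → Set) (b : ℕ) (ω : ℕ → ℤ) (ω-ordering : IsBOrdering S b ω) where

  Σα≤pairSum : ∀ n X → length X ≡ suc n → All S X → Σ< (suc n) (α b ω) ≤∞ pairSum b X
  Σα≤pairSum zero    (x ∷ []) _ _ = ≤∞-refl (fin 0)
  Σα≤pairSum (suc n) X |X|≡2+n SX
    with ∃-point-ordDiffSum-≤-rest b (applyDownFrom ω (suc n)) X
           (≡-trans |X|≡2+n (cong suc (sym (length-applyDownFrom ω (suc n)))))
  ... | x , Y , X↭xY , ω≤Y with All-resp-↭ X↭xY SX
  ...   | Sx ∷ SY = subst (Σ< (suc (suc n)) (α b ω) ≤∞_) (sym (pairSum-↭ b X↭xY))
          (+∞-mono-≤∞ (Σα≤pairSum n Y (suc-injective (≡-trans (sym (↭-length X↭xY)) |X|≡2+n)) SY) αₙ₊₁≤Y)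
    where
    αₙ₊₁≤Y : α b ω (suc n) ≤∞ ordDiffSum b x Y
    αₙ₊₁≤Y = ≤∞-trans (proj₂ ω-ordering (suc n) (s≤s z≤n) x Sx)
               (subst (_≤∞ ordDiffSum b x Y) (ordDiffSum-applyDownFrom b x ω (suc n)) ω≤Y)

  Σα≤γ : ∀ n (a : ℕ → ℤ) → (∀ i → i ≤ n → S (a i)) → Σ< (suc n) (α b ω) ≤∞ γ b a n
  Σα≤γ n a Sa = subst (Σ< (suc n) (α b ω) ≤∞_) (pairSum-applyDownFrom b a n)
    (Σα≤pairSum n (applyDownFrom a (suc n)) (length-applyDownFrom a (suc n))
      (All-applyDownFrom a (suc n) (λ i i<1+n → Sa i (≤-pred i<1+n))))

1^∞ : ∀ t → 1 ^∞ t ≡ 1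
1^∞ (fin k) = ^-zeroˡ k
1^∞ ∞       = ≡-refl

^∞-distribˡ-+∞-* : ∀ b s t → b ^∞ (s +∞ t) ≡ b ^∞ s * b ^∞ t
^∞-distribˡ-+∞-* b             (fin m) (fin n) = ^-distribˡ-+-* b m n
^∞-distribˡ-+∞-* zero          (fin m) ∞       = sym (*-zeroʳ (0 ^ m))
^∞-distribˡ-+∞-* (suc zero)    (fin m) ∞       = cong (_* 1) (sym (^-zeroˡ m))
^∞-distribˡ-+∞-* (suc (suc c)) (fin m) ∞       = sym (*-zeroʳ (suc (suc c) ^ m))
^∞-distribˡ-+∞-* zero          ∞       t       = ≡-refl
^∞-distribˡ-+∞-* (suc zero)    ∞       t       = sym (≡-trans (*-identityˡ _) (1^∞ t))
^∞-distribˡ-+∞-* (suc (suc c)) ∞       t       = ≡-refl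

^∞-mono-∣ : ∀ b {s t} → s ≤∞ t → b ^∞ s ∣ b ^∞ t
^∞-mono-∣ b             (fin≤fin {m} {n} m≤n) = divides (b ^ (n ∸ m)) (begin
  b ^ n               ≡⟨ cong (b ^_) (sym (m+[n∸m]≡n m≤n)) ⟩
  b ^ (m + (n ∸ m))   ≡⟨ ^-distribˡ-+-* b m (n ∸ m) ⟩
  b ^ m * b ^ (n ∸ m) ≡⟨ *-comm (b ^ m) _ ⟩
  b ^ (n ∸ m) * b ^ m ∎)
  where open ≡-Reasoning
^∞-mono-∣ zero          (s ≤∞∞) = _ ∣0
^∞-mono-∣ (suc zero)    (s ≤∞∞) = ∣-reflexive (1^∞ s)
^∞-mono-∣ (suc (suc c)) (s ≤∞∞) = _ ∣0

^∞-Σ< : ∀ b n (t : ℕ → ℕ∞) → b ^∞ Σ< (suc n) t ≡ ∏≤ n (λ k → b ^∞ t k)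
^∞-Σ< b zero    t = cong (b ^∞_) (+∞-identityˡ (t 0))
^∞-Σ< b (suc n) t = ≡-trans (^∞-distribˡ-+∞-* b (Σ< (suc n) t) (t (suc n)))
                            (cong (_* b ^∞ t (suc n)) (^∞-Σ< b n t))

product-map-* : ∀ (f g : ℕ → ℕ) L → product (map (λ c → f c * g c) L) ≡ product (map f L) * product (map g L)
product-map-* f g []      = ≡-refl
product-map-* f g (c ∷ L) = begin
  (f c * g c) * product (map (λ c → f c * g c) L) ≡⟨ cong (f c * g c *_) (product-map-* f g L) ⟩
  (f c * g c) * (product (map f L) * product (map g L)) ≡⟨ interchange-* (f c) (g c) _ _ ⟩
  (f c * product (map f L)) * (g c * product (map g L)) ∎
  where
  open ≡-Reasoning
  interchange-* : ∀ w x y z → (w * x) * (y * z) ≡ (w * y) * (x * z)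
  interchange-* = CommSemigroupProperties.interchange *-commutativeSemigroup

product-map-∣ : ∀ (f g : ℕ → ℕ) L → (∀ c → f c ∣ g c) → product (map f L) ∣ product (map g L)
product-map-∣ f g []      f∣g = ∣-refl
product-map-∣ f g (c ∷ L) f∣g = *-pres-∣ (f∣g c) (product-map-∣ f g L f∣g)

product-map-∣-cover : ∀ (f : ℕ → ℕ) L₁ L₂ → Unique L₁ →
  (∀ c → c ∈ L₁ → f c ≢ 1 → c ∈ L₂) → product (map f L₁) ∣ product (map f L₂)
product-map-∣-cover f []       L₂ _           _     = 1∣ _
product-map-∣-cover f (c ∷ L₁) L₂ (c∉L₁ ∷ L₁!) cover with f c ≟ 1
... | yes fc≡1 = subst (_∣ product (map f L₂))
                   (sym (≡-trans (cong (_* product (map f L₁)) fc≡1) (*-identityˡ _)))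
                   (product-map-∣-cover f L₁ L₂ L₁! (λ c′ → cover c′ ∘ there))
... | no fc≢1 with ∈-∃++ (cover c (here ≡-refl) fc≢1)
...   | P , Q , ≡-refl = subst (f c * product (map f L₁) ∣_) (sym (product-↭ (map⁺ f (shift c P Q))))
          (*-monoʳ-∣ (f c) (product-map-∣-cover f L₁ (P ++ Q) L₁! cover′))
  where
  cover′ : ∀ c′ → c′ ∈ L₁ → f c′ ≢ 1 → c′ ∈ P ++ Q
  cover′ c′ c′∈L₁ fc′≢1 with ∈-resp-↭ (shift c P Q) (cover c′ (there c′∈L₁) fc′≢1)
  ... | here c′≡c    = ⊥-elim (All.lookup c∉L₁ c′∈L₁ (sym c′≡c))
  ... | there c′∈P++Q = c′∈P++Q

∏≤-mono-∣ : ∀ n {f g : ℕ → ℕ} → (∀ k → k ≤ n → f k ∣ g k) → ∏≤ n f ∣ ∏≤ n g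
∏≤-mono-∣ zero    f∣g = f∣g 0 z≤n
∏≤-mono-∣ (suc n) f∣g = *-pres-∣ (∏≤-mono-∣ n (λ k k≤n → f∣g k (m≤n⇒m≤1+n k≤n))) (f∣g (suc n) ≤-refl)

∏≤-product-map : ∀ n (F : ℕ → ℕ → ℕ) L →
  ∏≤ n (λ k → product (map (F k) L)) ≡ product (map (λ c → ∏≤ n (λ k → F k c)) L)
∏≤-product-map zero    F L = ≡-refl
∏≤-product-map (suc n) F L = ≡-trans (cong (_* product (map (F (suc n)) L)) (∏≤-product-map n F L))
  (sym (product-map-* (λ c → ∏≤ n (λ k → F k c)) (F (suc n)) L))

IsProd-∣ : ∀ {T f g x y} → (∀ b → f b ∣ g b) → IsProd T f x → IsProd T g y → x ∣ y
IsProd-∣ f∣g _ (inj₁ (_ , y≡0)) = subst (_ ∣_) (sym y≡0) (_ ∣0)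
IsProd-∣ {g = g} {x} {y} f∣g (inj₁ ((c , Tc , fc≡0) , x≡0)) (inj₂ (L , _ , _ , cover , y≡)) = begin
  x                  ≡⟨ x≡0 ⟩
  0                  ≡⟨ gc≡0 ⟨
  g c                ∣⟨ ∈⇒∣product (∈-map⁺ g c∈L) ⟩
  product (map g L)  ≡⟨ y≡ ⟨
  y                  ∎
  where
  open ∣-Reasoning
  gc≡0 : g c ≡ 0
  gc≡0 = 0∣⇒≡0 (subst (_∣ g c) fc≡0 (f∣g c))
  c∈L : c ∈ L
  c∈L = cover c Tc (λ gc≡1 → 0≢1+n (≡-trans (sym gc≡0) gc≡1))
IsProd-∣ {f = f} {g} {x} {y} f∣g (inj₂ (L₁ , L₁! , TL₁ , _ , x≡)) (inj₂ (L₂ , _ , _ , cover₂ , y≡)) = begin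
  x                    ≡⟨ x≡ ⟩
  product (map f L₁)   ∣⟨ product-map-∣ f g L₁ f∣g ⟩
  product (map g L₁)   ∣⟨ product-map-∣-cover g L₁ L₂ L₁! (λ c c∈L₁ → cover₂ c (All.lookup TL₁ c∈L₁)) ⟩
  product (map g L₂)   ≡⟨ y≡ ⟨
  y                    ∎
  where open ∣-Reasoning

IsProd-restrict : ∀ {T} (f g : ℕ → ℕ) {L} → Unique L → All T L → (∀ b → T b → g b ≢ 1 → b ∈ L) →
  (∀ b → f b ∣ g b) → IsProd T f (product (map f L))
IsProd-restrict f g L! TL cover f∣g =
  inj₂ (_ , L! , TL , (λ b Tb fb≢1 → cover b Tb (λ gb≡1 → fb≢1 (∣1⇒≡1 (subst (f b ∣_) gb≡1 (f∣g b))))) , ≡-refl)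

theorem3p15 : (S : ℤ → Set) → ∃ S → (n : ℕ) → (a : ℕ → ℤ) → (∀ i → i ≤ n → S (a i)) →
    (T : ℕ → Set) →
    (ω : ℕ → ℕ → ℤ) → (∀ b → IsBOrdering S b (ω b)) →
    (fact : ℕ → ℕ) → (∀ k → k ≤ n → IsProd T (λ b → b ^∞ α b (ω b) k) (fact k)) →
    (m : ℕ) → IsProd T (λ b → b ^∞ γ b a n) m →
    ∏≤ n fact ∣ m
-- Nonemptiness of S only matters for b-orderings to exist; here they are given.
theorem3p15 S _ n a Sa T ω ω-ordering fact fact-prod m (inj₁ (_ , m≡0)) = subst (_ ∣_) (sym m≡0) (_ ∣0)
theorem3p15 S _ n a Sa T ω ω-ordering fact fact-prod m (inj₂ (L , L! , TL , cover , m≡)) = begin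
  ∏≤ n fact                                      ∣⟨ ∏≤-mono-∣ n fact∣ ⟩
  ∏≤ n (λ k → product (map (αpow k) L))          ≡⟨ ∏≤-product-map n αpow L ⟩
  product (map (λ b → ∏≤ n (λ k → αpow k b)) L)  ≡⟨ cong product (map-cong (λ b → ^∞-Σ< b n (α b (ω b))) L) ⟨
  product (map Σαpow L)                          ∣⟨ product-map-∣ Σαpow γpow L (λ b → ^∞-mono-∣ b (Σα≤γᵇ b)) ⟩
  product (map γpow L)                           ≡⟨ m≡ ⟨
  m                                              ∎
  where
  open ∣-Reasoning
  αpow : ℕ → ℕ → ℕ
  αpow k b = b ^∞ α b (ω b) k
  Σαpow γpow : ℕ → ℕ
  Σαpow b = b ^∞ Σ< (suc n) (α b (ω b))
  γpow b = b ^∞ γ b a n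
  Σα≤γᵇ : ∀ b → Σ< (suc n) (α b (ω b)) ≤∞ γ b a n
  Σα≤γᵇ b = Σα≤γ S b (ω b) (ω-ordering b) n a Sa
  αpow∣γpow : ∀ k → k ≤ n → ∀ b → αpow k b ∣ γpow b
  αpow∣γpow k k≤n b = ^∞-mono-∣ b (≤∞-trans (term≤∞Σ< (α b (ω b)) (s≤s k≤n)) (Σα≤γᵇ b))
  fact∣ : ∀ k → k ≤ n → fact k ∣ product (map (αpow k) L)
  fact∣ k k≤n = IsProd-∣ (λ _ → ∣-refl) (fact-prod k k≤n)
                  (IsProd-restrict (αpow k) γpow L! TL cover (αpow∣γpow k k≤n))
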